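{- Let $F:\mathcal{C}\to\mathcal{D}$ be a trivial fibration between CwFs, and suppose $\mathcal{D}$ is equipped with a weakly stable weak identity type structure. Then $\mathcal{C}$ can be equipped with a weakly stable weak identity type structure that is strictly preserved by $F$, i.e. $F(\mathsf{Id}_{(\Gamma,A,x)})=\mathsf{Id}_{(F\Gamma,FA,Fx)}$, $F(\mathsf{refl}_{(\Gamma,A,x)})=\mathsf{refl}_{(F\Gamma,FA,Fx)}$, and likewise $F$ sends $\mathsf{J}$ and $\mathsf{J}\beta$ of each elimination context to those of the image elimination context.
   Context: A CwF consists of a category with terminal object, a presheaf $\mathsf{Ty}$ of types, sets $\mathsf{Tm}(\Gamma,A)$ of terms with functorial substitution, and context extensions $\Gamma.A$ with $\mathbf{p}_A$, $\mathbf{q}_A$ such that maps $\Delta\to\Gamma.A$ correspond to pairs $(\rho:\Delta\to\Gamma,\ a\in\mathsf{Tm}(\Delta,A[\rho]))$; $\rho^+=\langle\rho\circ\mathbf{p},\mathbf{q}\rangle$. CwF morphisms preserve everything strictly. $F:\mathcal{C}\to\mathcal{D}$ is a trivial fibration if it is equipped with chosen lifts: for every object $\Gamma$ of $\mathcal{C}$ and $A\in\mathsf{Ty}_{\mathcal{D}}(F\Gamma)$ some $A_0\in\mathsf{Ty}_{\mathcal{C}}(\Gamma)$ with $F(A_0)=A$, and for every $A\in\mathsf{Ty}_{\mathcal{C}}(\Gamma)$ and $a\in\mathsf{Tm}_{\mathcal{D}}(F\Gamma,FA)$ some $a_0\in\mathsf{Tm}_{\mathcal{C}}(\Gamma,A)$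 with $F(a_0)=a$. A weakly stable weak identity type structure: for every $(\Gamma,A,x)$ with $A\in\mathsf{Ty}(\Gamma)$, $x\in\mathsf{Tm}(\Gamma,A)$, a type $\mathsf{Id}_{(\Gamma,A,x)}\in\mathsf{Ty}(\Gamma.A)$ and $\mathsf{refl}_{(\Gamma,A,x)}\in\mathsf{Tm}(\Gamma,\mathsf{Id}_{(\Gamma,A,x)}[\langle\mathrm{id},x\rangle])$; for every $\gamma:\Delta\to\Gamma$, $P\in\mathsf{Ty}(\Delta.A[\gamma].\mathsf{Id}_{(\Gamma,A,x)}[\gamma^+])$ and $d\in\mathsf{Tm}(\Delta,P')$, where $P'=P[\langle\mathrm{id},x[\gamma],\mathsf{refl}_{(\Gamma,A,x)}[\gamma]\rangle]$, terms $\mathsf{J}_{(\Gamma,A,x,\Delta,\gamma,P,d)}\in\mathsf{Tm}(\Delta.A[\gamma].\mathsf{Id}_{(\Gamma,A,x)}[\gamma^+],P)$ and $\mathsf{J}\beta_{(\Gamma,A,x,\Delta,\gamma,P,d)}\in\mathsf{Tm}(\Delta,\mathsf{Id}_{(\Delta,P',d)}[\langle\mathrm{id},\mathsf{J}_{(\dots)}[\langle\mathrm{id},x[\gamma],\mathsf{refl}_{(\Gamma,A,x)}[\gamma]\rangle]\rangle])$. No naturality with respect to substitution is required. -}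

module Defs where

open import Level using (Level; _⊔_) renaming (suc to lsuc)
open import Relation.Binary.PropositionalEquality
  using (_≡_; refl; sym; trans; cong; subst)
open import Data.Product using (Σ; _,_; proj₁; proj₂)

-- Categories with families (strict equalities; Agda's ≡ with K, so
-- all sorts are sets).

record CwF (o h t u : Level) : Set (lsuc (o ⊔ h ⊔ t ⊔ u)) where
  infixl 9 _∘_
  infixl 8 _[_]T _[_]t
  infixl 7 _▹_
  field
    Ob    : Set o
    Hom   : Ob → Ob → Set h
    id    : ∀ {Γ} → Hom Γ Γ
    _∘_   : ∀ {Γ Δ Θ} → Hom Δ Θ → Hom Γ Δ → Hom Γ Θ
    idl   : ∀ {Γ Δ} (σ : Hom Γ Δ) → id ∘ σ ≡ σ
    idr   : ∀ {Γ Δ} (σ : Hom Γ Δ) → σ ∘ id ≡ σ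
    assoc : ∀ {Γ Δ Θ Ξ} (σ : Hom Θ Ξ) (τ : Hom Δ Θ) (υ : Hom Γ Δ) →
            (σ ∘ τ) ∘ υ ≡ σ ∘ (τ ∘ υ)
    ◇     : Ob
    ε     : ∀ {Γ} → Hom Γ ◇
    ε-η   : ∀ {Γ} (σ : Hom Γ ◇) → σ ≡ ε
    Ty    : Ob → Set t
    _[_]T : ∀ {Γ Δ} → Ty Γ → Hom Δ Γ → Ty Δ
    [id]T : ∀ {Γ} (A : Ty Γ) → A [ id ]T ≡ A
    [∘]T  : ∀ {Γ Δ Θ} (A : Ty Θ) (σ : Hom Δ Θ) (τ : Hom Γ Δ) →
            A [ σ ∘ τ ]T ≡ A [ σ ]T [ τ ]T
    Tm    : (Γ : Ob) → Ty Γ → Set u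
    _[_]t : ∀ {Γ Δ} {A : Ty Γ} → Tm Γ A → (σ : Hom Δ Γ) → Tm Δ (A [ σ ]T)
    [id]t : ∀ {Γ} {A : Ty Γ} (a : Tm Γ A) →
            subst (Tm Γ) ([id]T A) (a [ id ]t) ≡ a
    [∘]t  : ∀ {Γ Δ Θ} {A : Ty Θ} (a : Tm Θ A) (σ : Hom Δ Θ) (τ : Hom Γ Δ) →
            subst (Tm Γ) ([∘]T A σ τ) (a [ σ ∘ τ ]t) ≡ a [ σ ]t [ τ ]t
    _▹_   : (Γ : Ob) → Ty Γ → Ob
    p     : ∀ {Γ} {A : Ty Γ} → Hom (Γ ▹ A) Γ
    q     : ∀ {Γ} {A : Ty Γ} → Tm (Γ ▹ A) (A [ p ]T)
    ⟨_,_⟩ : ∀ {Γ Δ} {A : Ty Γ} (σ : Hom Δ Γ) → Tm Δ (A [ σ ]T) → Hom Δ (Γ ▹ A)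
    p∘⟨⟩  : ∀ {Γ Δ} {A : Ty Γ} (σ : Hom Δ Γ) (a : Tm Δ (A [ σ ]T)) →
            p ∘ ⟨ σ , a ⟩ ≡ σ
    q[⟨⟩] : ∀ {Γ Δ} {A : Ty Γ} (σ : Hom Δ Γ) (a : Tm Δ (A [ σ ]T)) →
            subst (Tm Δ) (trans (sym ([∘]T A p ⟨ σ , a ⟩)) (cong (A [_]T) (p∘⟨⟩ σ a)))
                  (q [ ⟨ σ , a ⟩ ]t) ≡ a
    ⟨⟩-η  : ∀ {Γ Δ} {A : Ty Γ} (τ : Hom Δ (Γ ▹ A)) →
            ⟨ p ∘ τ , subst (Tm Δ) (sym ([∘]T A p τ)) (q [ τ ]t) ⟩ ≡ τ

module CwFOps {o h t u} (C : CwF o h t u) where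
  open CwF C

  TmΣ : Ob → Set (t ⊔ u)
  TmΣ Γ = Σ (Ty Γ) (Tm Γ)

  ⌜_⌝ : ∀ {Γ} {A : Ty Γ} → Tm Γ A → TmΣ Γ
  ⌜_⌝ {A = A} a = A , a

  substΣ : ∀ {Γ} {A B : Ty Γ} (e : A ≡ B) (a : Tm Γ A) → ⌜ a ⌝ ≡ ⌜ subst (Tm Γ) e a ⌝
  substΣ refl a = refl

  Σ→subst : ∀ {Γ} {A B : Ty Γ} {a : Tm Γ A} {b : Tm Γ B} →
            ⌜ a ⌝ ≡ ⌜ b ⌝ → (e : A ≡ B) → subst (Tm Γ) e a ≡ b
  Σ→subst refl refl = refl

  subΣ : ∀ {Γ Δ} (σ : Hom Δ Γ) → TmΣ Γ → TmΣ Δ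
  subΣ σ (A , a) = A [ σ ]T , a [ σ ]t

  ⟨_⟩ₓ : ∀ {Γ} {A : Ty Γ} → Tm Γ A → Hom Γ (Γ ▹ A)
  ⟨_⟩ₓ {Γ} {A} x = ⟨ id , subst (Tm Γ) (sym ([id]T A)) x ⟩

  _⁺ : ∀ {Γ Δ} {A : Ty Γ} (γ : Hom Δ Γ) → Hom (Δ ▹ A [ γ ]T) (Γ ▹ A)
  _⁺ {A = A} γ = ⟨ γ ∘ p , subst (Tm _) (sym ([∘]T A γ p)) q ⟩

  private
    q∘ : ∀ {Γ Δ Θ} {A : Ty Θ} (σ : Hom Δ (Θ ▹ A)) (τ : Hom Γ Δ) →
         ⌜ q [ σ ∘ τ ]t ⌝ ≡ ⌜ q [ σ ]t [ τ ]t ⌝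
    q∘ {A = A} σ τ = trans (substΣ ([∘]T (A [ p ]T) σ τ) (q [ σ ∘ τ ]t))
                           (cong ⌜_⌝ ([∘]t q σ τ))

    q⟨⟩ : ∀ {Γ Δ} {A : Ty Γ} (σ : Hom Δ Γ) (a : Tm Δ (A [ σ ]T)) →
          ⌜ q [ ⟨ σ , a ⟩ ]t ⌝ ≡ ⌜ a ⌝
    q⟨⟩ {A = A} σ a = trans (substΣ _ (q [ ⟨ σ , a ⟩ ]t)) (cong ⌜_⌝ (q[⟨⟩] σ a))

    pair-cong : ∀ {Γ Δ} {A : Ty Γ} {σ σ' : Hom Δ Γ}
                {a : Tm Δ (A [ σ ]T)} {a' : Tm Δ (A [ σ' ]T)} →
                σ ≡ σ' → ⌜ a ⌝ ≡ ⌜ a' ⌝ → ⟨ σ , a ⟩ ≡ ⟨ σ' , a' ⟩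
    pair-cong {a = a} refl e = cong ⟨ _ ,_⟩ (Σ→subst e refl)

    ext : ∀ {Γ Δ} {A : Ty Γ} (τ₁ τ₂ : Hom Δ (Γ ▹ A)) →
          p ∘ τ₁ ≡ p ∘ τ₂ → ⌜ q [ τ₁ ]t ⌝ ≡ ⌜ q [ τ₂ ]t ⌝ → τ₁ ≡ τ₂
    ext {A = A} τ₁ τ₂ e₁ e₂ =
      trans (sym (⟨⟩-η τ₁))
        (trans (pair-cong e₁
                 (trans (sym (substΣ (sym ([∘]T A p τ₁)) (q [ τ₁ ]t)))
                   (trans e₂ (substΣ (sym ([∘]T A p τ₂)) (q [ τ₂ ]t)))))
          (⟨⟩-η τ₂))

    xΣ : ∀ {Γ} {A : Ty Γ} (x : Tm Γ A) →
         ⌜ q [ ⟨ x ⟩ₓ ]t ⌝ ≡ ⌜ x ⌝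
    xΣ {A = A} x = trans (q⟨⟩ id _) (sym (substΣ (sym ([id]T A)) x))

  ⁺-lemma : ∀ {Γ Δ} {A : Ty Γ} (x : Tm Γ A) (γ : Hom Δ Γ) →
            ⟨ x ⟩ₓ ∘ γ ≡ (γ ⁺) ∘ ⟨ x [ γ ]t ⟩ₓ
  ⁺-lemma {A = A} x γ = ext _ _
    (trans (sym (assoc p ⟨ x ⟩ₓ γ))
      (trans (cong (_∘ γ) (p∘⟨⟩ id _))
        (trans (idl γ)
          (sym (trans (sym (assoc p (γ ⁺) ⟨ x [ γ ]t ⟩ₓ))
                 (trans (cong (_∘ ⟨ x [ γ ]t ⟩ₓ) (p∘⟨⟩ (γ ∘ p) _))
                   (trans (assoc γ p ⟨ x [ γ ]t ⟩ₓ)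
                     (trans (cong (γ ∘_) (p∘⟨⟩ id _)) (idr γ)))))))))
    (trans (q∘ ⟨ x ⟩ₓ γ)
      (trans (cong (subΣ γ) (xΣ x))
        (sym (trans (q∘ (γ ⁺) ⟨ x [ γ ]t ⟩ₓ)
               (trans (cong (subΣ ⟨ x [ γ ]t ⟩ₓ)
                        (trans (q⟨⟩ (γ ∘ p) _)
                          (sym (substΣ (sym ([∘]T A γ p)) q))))
                 (xΣ (x [ γ ]t)))))))

  ⟨id,_[_],_⟩ : ∀ {Γ Δ} {A : Ty Γ} {B : Ty (Γ ▹ A)}
                (x : Tm Γ A) (γ : Hom Δ Γ) →
                Tm Γ (B [ ⟨ x ⟩ₓ ]T) → Hom Δ (Δ ▹ A [ γ ]T ▹ B [ γ ⁺ ]T)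
  ⟨id,_[_],_⟩ {Δ = Δ} {B = B} x γ r =
    ⟨ ⟨ x [ γ ]t ⟩ₓ ,
      subst (Tm Δ) (trans (sym ([∘]T B ⟨ x ⟩ₓ γ))
                     (trans (cong (B [_]T) (⁺-lemma x γ)) ([∘]T B (γ ⁺) ⟨ x [ γ ]t ⟩ₓ)))
            (r [ γ ]t) ⟩

-- Weakly stable weak identity type structure (no naturality required)

record IdStr {o h t u} (C : CwF o h t u) : Set (o ⊔ h ⊔ t ⊔ u) where
  open CwF C
  open CwFOps C
  field
    Id   : (Γ : Ob) (A : Ty Γ) (x : Tm Γ A) → Ty (Γ ▹ A)
    rfl  : (Γ : Ob) (A : Ty Γ) (x : Tm Γ A) → Tm Γ (Id Γ A x [ ⟨ x ⟩ₓ ]T)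

  σJ : ∀ {Γ Δ} (A : Ty Γ) (x : Tm Γ A) (γ : Hom Δ Γ) →
       Hom Δ (Δ ▹ A [ γ ]T ▹ Id Γ A x [ γ ⁺ ]T)
  σJ {Γ} A x γ = ⟨id, x [ γ ], rfl Γ A x ⟩

  field
    J    : (Γ : Ob) (A : Ty Γ) (x : Tm Γ A) (Δ : Ob) (γ : Hom Δ Γ)
           (P : Ty (Δ ▹ A [ γ ]T ▹ Id Γ A x [ γ ⁺ ]T))
           (d : Tm Δ (P [ σJ A x γ ]T)) →
           Tm (Δ ▹ A [ γ ]T ▹ Id Γ A x [ γ ⁺ ]T) P
    Jβ   : (Γ : Ob) (A : Ty Γ) (x : Tm Γ A) (Δ : Ob) (γ : Hom Δ Γ)
           (P : Ty (Δ ▹ A [ γ ]T ▹ Id Γ A x [ γ ⁺ ]T))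
           (d : Tm Δ (P [ σJ A x γ ]T)) →
           Tm Δ (Id Δ (P [ σJ A x γ ]T) d
                   [ ⟨ J Γ A x Δ γ P d [ σJ A x γ ]t ⟩ₓ ]T)

record Morphism {o h t u o' h' t' u'} (C : CwF o h t u) (D : CwF o' h' t' u')
       : Set (o ⊔ h ⊔ t ⊔ u ⊔ o' ⊔ h' ⊔ t' ⊔ u') where
  private
    module C = CwF C
    module D = CwF D
  field
    F₀    : C.Ob → D.Ob
    F₁    : ∀ {Δ Γ} → C.Hom Δ Γ → D.Hom (F₀ Δ) (F₀ Γ)
    F-id  : ∀ {Γ} → F₁ (C.id {Γ}) ≡ D.id
    F-∘   : ∀ {Γ Δ Θ} (σ : C.Hom Δ Θ) (τ : C.Hom Γ Δ) →
            F₁ (σ C.∘ τ) ≡ F₁ σ D.∘ F₁ τ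
    F-◇   : F₀ C.◇ ≡ D.◇
    FTy   : ∀ {Γ} → C.Ty Γ → D.Ty (F₀ Γ)
    FTy-[] : ∀ {Γ Δ} (A : C.Ty Γ) (σ : C.Hom Δ Γ) →
             FTy (A C.[ σ ]T) ≡ FTy A D.[ F₁ σ ]T
    FTm   : ∀ {Γ} {A : C.Ty Γ} → C.Tm Γ A → D.Tm (F₀ Γ) (FTy A)
    FTm-[] : ∀ {Γ Δ} {A : C.Ty Γ} (a : C.Tm Γ A) (σ : C.Hom Δ Γ) →
             subst (D.Tm (F₀ Δ)) (FTy-[] A σ) (FTm (a C.[ σ ]t)) ≡ FTm a D.[ F₁ σ ]t
    F-▹p  : ∀ {Γ} (A : C.Ty Γ) →
            _≡_ {A = Σ D.Ob (λ X → D.Hom X (F₀ Γ))}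
                (F₀ (Γ C.▹ A) , F₁ C.p) (F₀ Γ D.▹ FTy A , D.p)
    F-q   : ∀ {Γ} (A : C.Ty Γ) →
            _≡_ {A = Σ D.Ob (λ X → Σ (D.Ty X) (D.Tm X))}
                (F₀ (Γ C.▹ A) , FTy (A C.[ C.p ]T) , FTm C.q)
                (F₀ Γ D.▹ FTy A , FTy A D.[ D.p ]T , D.q)

-- Trivial fibrations (with chosen lifts)

record TrivialFibration {o h t u o' h' t' u'} {C : CwF o h t u} {D : CwF o' h' t' u'}
       (F : Morphism C D) : Set (o ⊔ h ⊔ t ⊔ u ⊔ o' ⊔ h' ⊔ t' ⊔ u') where
  private
    module C = CwF C
    module D = CwF D
  open Morphism F
  field
    liftTy : (Γ : C.Ob) (A : D.Ty (F₀ Γ)) → Σ (C.Ty Γ) (λ A₀ → FTy A₀ ≡ A)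
    liftTm : (Γ : C.Ob) (A : C.Ty Γ) (a : D.Tm (F₀ Γ) (FTy A)) →
             Σ (C.Tm Γ A) (λ a₀ → FTm a₀ ≡ a)

record PreservesId {o h t u o' h' t' u'} {C : CwF o h t u} {D : CwF o' h' t' u'}
       (F : Morphism C D) (IC : IdStr C) (ID : IdStr D)
       : Set (o ⊔ h ⊔ t ⊔ u ⊔ o' ⊔ h' ⊔ t' ⊔ u') where
  private
    module C = CwF C
    module D = CwF D
    module OC = CwFOps C
    module OD = CwFOps D
    module IC = IdStr IC
    module ID = IdStr ID
  open Morphism F
  field
    Id-pres   : (Γ : C.Ob) (A : C.Ty Γ) (x : C.Tm Γ A) →
                _≡_ {A = Σ D.Ob D.Ty}
                    (F₀ (Γ C.▹ A) , FTy (IC.Id Γ A x))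
                    (F₀ Γ D.▹ FTy A , ID.Id (F₀ Γ) (FTy A) (FTm x))
    refl-pres : (Γ : C.Ob) (A : C.Ty Γ) (x : C.Tm Γ A) →
                _≡_ {A = Σ (D.Ty (F₀ Γ)) (D.Tm (F₀ Γ))}
                    (_ , FTm (IC.rfl Γ A x))
                    (_ , ID.rfl (F₀ Γ) (FTy A) (FTm x))
    -- F(J_(Γ,A,x,Δ,γ,P,d)) = J_(FΓ,FA,Fx,FΔ,Fγ,FP,Fd), where FP and Fd
    -- are (the unique) P̃, d̃ corresponding to F P and F d
    J-pres    : (Γ : C.Ob) (A : C.Ty Γ) (x : C.Tm Γ A) (Δ : C.Ob) (γ : C.Hom Δ Γ)
                (P : C.Ty (Δ C.▹ A C.[ γ ]T C.▹ IC.Id Γ A x C.[ γ OC.⁺ ]T))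
                (d : C.Tm Δ (P C.[ IC.σJ A x γ ]T))
                (P̃ : D.Ty (F₀ Δ D.▹ FTy A D.[ F₁ γ ]T
                           D.▹ ID.Id (F₀ Γ) (FTy A) (FTm x) D.[ F₁ γ OD.⁺ ]T))
                (d̃ : D.Tm (F₀ Δ) (P̃ D.[ ID.σJ (FTy A) (FTm x) (F₁ γ) ]T)) →
                _≡_ {A = Σ D.Ob D.Ty}
                    (F₀ (Δ C.▹ A C.[ γ ]T C.▹ IC.Id Γ A x C.[ γ OC.⁺ ]T) , FTy P)
                    (_ , P̃) →
                _≡_ {A = Σ (D.Ty (F₀ Δ)) (D.Tm (F₀ Δ))} (_ , FTm d) (_ , d̃) →
                _≡_ {A = Σ D.Ob (λ X → Σ (D.Ty X) (D.Tm X))}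
                    (_ , FTy P , FTm (IC.J Γ A x Δ γ P d))
                    (_ , P̃ , ID.J (F₀ Γ) (FTy A) (FTm x) (F₀ Δ) (F₁ γ) P̃ d̃)
    Jβ-pres   : (Γ : C.Ob) (A : C.Ty Γ) (x : C.Tm Γ A) (Δ : C.Ob) (γ : C.Hom Δ Γ)
                (P : C.Ty (Δ C.▹ A C.[ γ ]T C.▹ IC.Id Γ A x C.[ γ OC.⁺ ]T))
                (d : C.Tm Δ (P C.[ IC.σJ A x γ ]T))
                (P̃ : D.Ty (F₀ Δ D.▹ FTy A D.[ F₁ γ ]T
                           D.▹ ID.Id (F₀ Γ) (FTy A) (FTm x) D.[ F₁ γ OD.⁺ ]T))
                (d̃ : D.Tm (F₀ Δ) (P̃ D.[ ID.σJ (FTy A) (FTm x) (F₁ γ) ]T)) →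
                _≡_ {A = Σ D.Ob D.Ty}
                    (F₀ (Δ C.▹ A C.[ γ ]T C.▹ IC.Id Γ A x C.[ γ OC.⁺ ]T) , FTy P)
                    (_ , P̃) →
                _≡_ {A = Σ (D.Ty (F₀ Δ)) (D.Tm (F₀ Δ))} (_ , FTm d) (_ , d̃) →
                _≡_ {A = Σ (D.Ty (F₀ Δ)) (D.Tm (F₀ Δ))}
                    (_ , FTm (IC.Jβ Γ A x Δ γ P d))
                    (_ , ID.Jβ (F₀ Γ) (FTy A) (FTm x) (F₀ Δ) (F₁ γ) P̃ d̃)

-- Every piece of the identity type structure of C is obtained by lifting the
-- corresponding piece of D along the trivial fibration F, so F preserves it by
-- construction. The only thing to check is that the lifted data are requested
-- at the right types: F must send the substitutions ⟨id , x⟩, γ⁺ and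
-- ⟨id , x[γ] , refl[γ]⟩ of C to those of D. This holds because F preserves
-- the CwF structure strictly and a map into a context extension is determined
-- by its composites with p and q. Equations between objects living over
-- different contexts are stated in the total spaces Σ Ob Ty, Σ Ob (Σ Ty Tm)
-- and Σ Ob (Σ Ob Hom), where they compose without transports.
module Submission where

open import Defs
open import Level using (Level)
open import Data.Product using (Σ; _,_; proj₁; proj₂)
open import Data.Product.Properties.WithK using (,-injectiveʳ)
open import Relation.Binary.PropositionalEquality
  using (_≡_; refl; sym; trans; cong; subst)

module Elements {o h t u} (C : CwF o h t u) where
  open CwF C
  open CwFOps C

  Ty∫ : Set _
  Ty∫ = Σ Ob Ty

  Tm∫ : Set _
  Tm∫ = Σ Ob (λ Γ → Σ (Ty Γ) (Tm Γ))

  Hom∫ : Set _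
  Hom∫ = Σ Ob (λ Δ → Σ Ob (Hom Δ))

  []T-cong : ∀ {W W' B B' Z Z' τ τ'} →
             _≡_ {A = Ty∫} (W , B) (W' , B') →
             _≡_ {A = Hom∫} (Z , W , τ) (Z' , W' , τ') →
             _≡_ {A = Ty∫} (Z , B [ τ ]T) (Z' , B' [ τ' ]T)
  []T-cong refl refl = refl

  []t-cong : ∀ {W W' B B' b b' Z Z' τ τ'} →
             _≡_ {A = Tm∫} (W , B , b) (W' , B' , b') →
             _≡_ {A = Hom∫} (Z , W , τ) (Z' , W' , τ') →
             _≡_ {A = Tm∫} (Z , B [ τ ]T , b [ τ ]t) (Z' , B' [ τ' ]T , b' [ τ' ]t)
  []t-cong refl refl = refl

  ∘-cong : ∀ {W W' Z Z' Y Y' σ σ' τ τ'} →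
           _≡_ {A = Hom∫} (Z , W , σ) (Z' , W' , σ') →
           _≡_ {A = Hom∫} (Y , Z , τ) (Y' , Z' , τ') →
           _≡_ {A = Hom∫} (Y , W , σ ∘ τ) (Y' , W' , σ' ∘ τ')
  ∘-cong refl refl = refl

  id-cong : ∀ {Z Z'} → Z ≡ Z' → _≡_ {A = Hom∫} (Z , Z , id) (Z' , Z' , id)
  id-cong refl = refl

  ▹-cong : ∀ {W W' B B'} → _≡_ {A = Ty∫} (W , B) (W' , B') → W ▹ B ≡ W' ▹ B'
  ▹-cong refl = refl

  p-cong : ∀ {W W' B B'} → _≡_ {A = Ty∫} (W , B) (W' , B') →
           _≡_ {A = Hom∫} (W ▹ B , W , p) (W' ▹ B' , W' , p)
  p-cong refl = refl

  q-cong : ∀ {W W' B B'} → _≡_ {A = Ty∫} (W , B) (W' , B') →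
           _≡_ {A = Tm∫} (W ▹ B , B [ p ]T , q) (W' ▹ B' , B' [ p ]T , q)
  q-cong refl = refl

  ⟨,⟩-cong : ∀ {W W' B B' Z Z' σ σ' a a'} →
             _≡_ {A = Ty∫} (W , B) (W' , B') →
             _≡_ {A = Hom∫} (Z , W , σ) (Z' , W' , σ') →
             _≡_ {A = Tm∫} (Z , B [ σ ]T , a) (Z' , B' [ σ' ]T , a') →
             _≡_ {A = Hom∫} (Z , W ▹ B , ⟨ σ , a ⟩) (Z' , W' ▹ B' , ⟨ σ' , a' ⟩)
  ⟨,⟩-cong refl refl refl = refl

  Ty∫-subst : ∀ {X Y} (e : X ≡ Y) (B : Ty X) →
              _≡_ {A = Ty∫} (X , B) (Y , subst Ty e B)
  Ty∫-subst refl B = refl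

  Tm∫-subst : ∀ {Z} {A A' : Ty Z} (e : A ≡ A') (a : Tm Z A) →
              _≡_ {A = Tm∫} (Z , A' , subst (Tm Z) e a) (Z , A , a)
  Tm∫-subst refl a = refl

  q[⟨,⟩]Σ : ∀ {Γ Δ} {A : Ty Γ} (σ : Hom Δ Γ) (a : Tm Δ (A [ σ ]T)) →
            ⌜ q [ ⟨ σ , a ⟩ ]t ⌝ ≡ ⌜ a ⌝
  q[⟨,⟩]Σ {A = A} σ a =
    trans (substΣ (trans (sym ([∘]T A p ⟨ σ , a ⟩)) (cong (A [_]T) (p∘⟨⟩ σ a)))
                  (q [ ⟨ σ , a ⟩ ]t))
          (cong ⌜_⌝ (q[⟨⟩] σ a))

  -- Uniqueness of pairing, for a comprehension X presented up to equality
  -- (as F(W ▹ B) is by a CwF morphism).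
  ⟨,⟩-unique : ∀ {Z X W} {B : Ty W} (τ : Hom Z X) {pX : Hom X W}
               {qX : Σ (Ty X) (Tm X)} {σ : Hom Z W} {a : Tm Z (B [ σ ]T)} →
               _≡_ {A = Σ Ob (λ Y → Hom Y W)} (X , pX) (W ▹ B , p) →
               _≡_ {A = Σ Ob (λ Y → Σ (Ty Y) (Tm Y))} (X , qX) (W ▹ B , B [ p ]T , q) →
               pX ∘ τ ≡ σ → subΣ τ qX ≡ ⌜ a ⌝ →
               _≡_ {A = Hom∫} (Z , X , τ) (Z , W ▹ B , ⟨ σ , a ⟩)
  ⟨,⟩-unique τ refl refl refl qτ≡a =
    cong (λ ρ → _ , _ , ρ)
      (trans (sym (⟨⟩-η τ))
        (cong ⟨ p ∘ τ ,_⟩ (Σ→subst (trans (sym (substΣ _ (q [ τ ]t))) qτ≡a) refl)))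

module IdStrCong {o h t u} (D : CwF o h t u) (ID : IdStr D) where
  open CwF D
  open Elements D
  open IdStr ID

  Id-cong : ∀ {Z Z' A A' a a'} → _≡_ {A = Tm∫} (Z , A , a) (Z' , A' , a') →
            _≡_ {A = Ty∫} (Z ▹ A , Id Z A a) (Z' ▹ A' , Id Z' A' a')
  Id-cong refl = refl

  J-cong : ∀ {Γ A x Δ γ P P' d d'} → P ≡ P' →
           _≡_ {A = Σ (Ty Δ) (Tm Δ)} (_ , d) (_ , d') →
           _≡_ {A = Tm∫} (_ , P , J Γ A x Δ γ P d) (_ , P' , J Γ A x Δ γ P' d')
  J-cong refl refl = refl

  Jβ-cong : ∀ {Γ A x Δ γ P P' d d'} → P ≡ P' →
            _≡_ {A = Σ (Ty Δ) (Tm Δ)} (_ , d) (_ , d') →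
            _≡_ {A = Σ (Ty Δ) (Tm Δ)} (_ , Jβ Γ A x Δ γ P d) (_ , Jβ Γ A x Δ γ P' d')
  Jβ-cong refl refl = refl

module MorphismAction {o h t u o' h' t' u'} {C : CwF o h t u} {D : CwF o' h' t' u'}
                      (F : Morphism C D) where
  private
    module C = CwF C
    module D = CwF D
    module OC = CwFOps C
    module OD = CwFOps D
  open Morphism F
  open Elements D

  F∫Ty : ∀ {Γ} → C.Ty Γ → Ty∫
  F∫Ty {Γ} A = F₀ Γ , FTy A

  F∫Tm : ∀ {Γ} {A : C.Ty Γ} → C.Tm Γ A → Tm∫
  F∫Tm {Γ} {A} a = F₀ Γ , FTy A , FTm a

  F∫Hom : ∀ {Z W} → C.Hom Z W → Hom∫
  F∫Hom {Z} {W} σ = F₀ Z , F₀ W , F₁ σ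

  FΣ : ∀ {Γ} → Σ (C.Ty Γ) (C.Tm Γ) → Σ (D.Ty (F₀ Γ)) (D.Tm (F₀ Γ))
  FΣ (A , a) = FTy A , FTm a

  FΣ-[] : ∀ {Γ Δ} {A : C.Ty Γ} (a : C.Tm Γ A) (σ : C.Hom Δ Γ) →
          FΣ OC.⌜ a C.[ σ ]t ⌝ ≡ OD.⌜ FTm a D.[ F₁ σ ]t ⌝
  FΣ-[] {A = A} a σ =
    trans (OD.substΣ (FTy-[] A σ) (FTm (a C.[ σ ]t))) (cong OD.⌜_⌝ (FTm-[] a σ))

  F₀-▹ : ∀ {Γ} (A : C.Ty Γ) → F₀ (Γ C.▹ A) ≡ F₀ Γ D.▹ FTy A
  F₀-▹ A = cong proj₁ (F-▹p A)

  F-⟨,⟩ : ∀ {Z W} {B : C.Ty W} (σ : C.Hom Z W) (a : C.Tm Z (B C.[ σ ]T)) →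
          F∫Hom (C.⟨_,_⟩ {A = B} σ a) ≡
            (F₀ Z , F₀ W D.▹ FTy B , D.⟨ F₁ σ , subst (D.Tm (F₀ Z)) (FTy-[] B σ) (FTm a) ⟩)
  F-⟨,⟩ {B = B} σ a = ⟨,⟩-unique (F₁ C.⟨ σ , a ⟩) (F-▹p B) (F-q B)
    (trans (sym (F-∘ C.p C.⟨ σ , a ⟩)) (cong F₁ (C.p∘⟨⟩ σ a)))
    (trans (sym (FΣ-[] C.q C.⟨ σ , a ⟩))
      (trans (cong FΣ (Elements.q[⟨,⟩]Σ C σ a)) (OD.substΣ (FTy-[] B σ) (FTm a))))

  F∫-▹ : ∀ {X} {B : C.Ty X} {W' B'} → F∫Ty B ≡ (W' , B') → F₀ (X C.▹ B) ≡ W' D.▹ B'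
  F∫-▹ {B = B} hB = trans (F₀-▹ B) (▹-cong hB)

  F∫-[]T : ∀ {Z W} {B : C.Ty W} {τ : C.Hom Z W} {Z' W' B' τ'} →
           F∫Ty B ≡ (W' , B') → F∫Hom τ ≡ (Z' , W' , τ') →
           F∫Ty (B C.[ τ ]T) ≡ (Z' , B' D.[ τ' ]T)
  F∫-[]T {B = B} {τ} hB hτ = trans (cong (F₀ _ ,_) (FTy-[] B τ)) ([]T-cong hB hτ)

  F∫-[]t : ∀ {Z W} {B : C.Ty W} {b : C.Tm W B} {τ : C.Hom Z W} {Z' W' B' b' τ'} →
           F∫Tm b ≡ (W' , B' , b') → F∫Hom τ ≡ (Z' , W' , τ') →
           F∫Tm (b C.[ τ ]t) ≡ (Z' , B' D.[ τ' ]T , b' D.[ τ' ]t)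
  F∫-[]t {b = b} {τ} hb hτ = trans (cong (F₀ _ ,_) (FΣ-[] b τ)) ([]t-cong hb hτ)

  F∫-subst : ∀ {Γ} {A A' : C.Ty Γ} (e : A ≡ A') (a : C.Tm Γ A) →
             F∫Tm (subst (C.Tm Γ) e a) ≡ F∫Tm a
  F∫-subst refl a = refl

  F∫-∘ : ∀ {Y Z W} {σ : C.Hom Z W} {τ : C.Hom Y Z} {Y' Z' W' σ' τ'} →
         F∫Hom σ ≡ (Z' , W' , σ') → F∫Hom τ ≡ (Y' , Z' , τ') →
         F∫Hom (σ C.∘ τ) ≡ (Y' , W' , σ' D.∘ τ')
  F∫-∘ {σ = σ} {τ} hσ hτ = trans (cong (λ ρ → F₀ _ , F₀ _ , ρ) (F-∘ σ τ)) (∘-cong hσ hτ)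

  F∫-id : ∀ {Z Z'} → F₀ Z ≡ Z' → F∫Hom (C.id {Z}) ≡ (Z' , Z' , D.id)
  F∫-id e = trans (cong (λ ρ → _ , _ , ρ) F-id) (id-cong e)

  F∫-p : ∀ {W} {A : C.Ty W} {W' A'} → F∫Ty A ≡ (W' , A') →
         F∫Hom (C.p {A = A}) ≡ (W' D.▹ A' , W' , D.p)
  F∫-p {A = A} hA = trans (cong (λ v → proj₁ v , F₀ _ , proj₂ v) (F-▹p A)) (p-cong hA)

  F∫-q : ∀ {W} {A : C.Ty W} {W' A'} → F∫Ty A ≡ (W' , A') →
         F∫Tm (C.q {A = A}) ≡ (W' D.▹ A' , A' D.[ D.p ]T , D.q)
  F∫-q {A = A} hA = trans (F-q A) (q-cong hA)

  F∫-⟨,⟩ : ∀ {Z W} {B : C.Ty W} {σ : C.Hom Z W} {a : C.Tm Z (B C.[ σ ]T)}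
             {Z' W' B' σ' a'} →
           F∫Ty B ≡ (W' , B') → F∫Hom σ ≡ (Z' , W' , σ') →
           F∫Tm a ≡ (Z' , B' D.[ σ' ]T , a') →
           F∫Hom (C.⟨_,_⟩ {A = B} σ a) ≡ (Z' , W' D.▹ B' , D.⟨ σ' , a' ⟩)
  F∫-⟨,⟩ {B = B} {σ} {a} hB hσ ha =
    trans (F-⟨,⟩ σ a) (⟨,⟩-cong hB hσ (trans (Tm∫-subst (FTy-[] B σ) (FTm a)) ha))

  F∫-⟨⟩ₓ : ∀ {Γ} {A : C.Ty Γ} {x : C.Tm Γ A} {Z' A' x'} →
           F∫Tm x ≡ (Z' , A' , x') → F∫Hom OC.⟨ x ⟩ₓ ≡ (Z' , Z' D.▹ A' , OD.⟨ x' ⟩ₓ)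
  F∫-⟨⟩ₓ {A = A} {x} {A' = A'} hx =
    F∫-⟨,⟩ (cong (λ v → proj₁ v , proj₁ (proj₂ v)) hx) (F∫-id (cong proj₁ hx))
      (trans (F∫-subst (sym (C.[id]T A)) x)
        (trans hx (sym (Tm∫-subst (sym (D.[id]T A')) _))))

  F∫-⁺ : ∀ {Z W} {A : C.Ty W} {γ : C.Hom Z W} {Z' W' A' γ'} →
         F∫Ty A ≡ (W' , A') → F∫Hom γ ≡ (Z' , W' , γ') →
         F∫Hom (OC._⁺ {A = A} γ) ≡ (Z' D.▹ A' D.[ γ' ]T , W' D.▹ A' , OD._⁺ {A = A'} γ')
  F∫-⁺ {A = A} {γ} {A' = A'} {γ'} hA hγ =
    F∫-⟨,⟩ hA (F∫-∘ hγ (F∫-p hAγ))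
      (trans (F∫-subst (sym (C.[∘]T A γ C.p)) C.q)
        (trans (F∫-q hAγ) (sym (Tm∫-subst (sym (D.[∘]T A' γ' D.p)) D.q))))
    where
      hAγ = F∫-[]T hA hγ

  F∫-⟨id,[],⟩ : ∀ {Γ Δ} {A : C.Ty Γ} {B : C.Ty (Γ C.▹ A)} {x : C.Tm Γ A}
                  {γ : C.Hom Δ Γ} {r : C.Tm Γ (B C.[ OC.⟨ x ⟩ₓ ]T)}
                  {Z' W'} {A' : D.Ty W'} {B' : D.Ty (W' D.▹ A')} {x' γ' r'} →
                F∫Ty B ≡ (W' D.▹ A' , B') → F∫Tm x ≡ (W' , A' , x') →
                F∫Hom γ ≡ (Z' , W' , γ') → F∫Tm r ≡ (W' , B' D.[ OD.⟨ x' ⟩ₓ ]T , r') →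
                F∫Hom (OC.⟨id,_[_],_⟩ {B = B} x γ r)
                  ≡ (Z' , _ , OD.⟨id,_[_],_⟩ {B = B'} x' γ' r')
  F∫-⟨id,[],⟩ {r = r} hB hx hγ hr =
    F∫-⟨,⟩ (F∫-[]T hB (F∫-⁺ (cong (λ v → proj₁ v , proj₁ (proj₂ v)) hx) hγ))
      (F∫-⟨⟩ₓ (F∫-[]t hx hγ))
      (trans (F∫-subst _ (r C.[ _ ]t)) (trans (F∫-[]t hr hγ) (sym (Tm∫-subst _ _))))

module Lifting {o h t u o' h' t' u'} {C : CwF o h t u} {D : CwF o' h' t' u'}
               {F : Morphism C D} (TF : TrivialFibration F) where
  private
    module C = CwF C
    module D = CwF D
  open Morphism F
  open TrivialFibration TF
  open MorphismAction F

  liftTy∫ : (Γ : C.Ob) {Y : D.Ob} → F₀ Γ ≡ Y → (B : D.Ty Y) →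
            Σ (C.Ty Γ) (λ A → F∫Ty A ≡ (Y , B))
  liftTy∫ Γ refl B = proj₁ (liftTy Γ B) , cong (F₀ Γ ,_) (proj₂ (liftTy Γ B))

  liftTm∫ : (Γ : C.Ob) (A : C.Ty Γ) {Y : D.Ob} {B : D.Ty Y} →
            F∫Ty A ≡ (Y , B) → (b : D.Tm Y B) →
            Σ (C.Tm Γ A) (λ a → F∫Tm a ≡ (Y , B , b))
  liftTm∫ Γ A refl b = proj₁ (liftTm Γ A b) , cong (λ c → _ , _ , c) (proj₂ (liftTm Γ A b))

module LiftedIdStr {o h t u o' h' t' u'} {C : CwF o h t u} {D : CwF o' h' t' u'}
                   (F : Morphism C D) (TF : TrivialFibration F) (ID : IdStr D) where
  private
    module C = CwF C
    module D = CwF D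
    module OC = CwFOps C
    module OD = CwFOps D
    module ID = IdStr ID
  open Morphism F
  open Elements D
  open IdStrCong D ID
  open MorphismAction F
  open Lifting TF

  IdC : (Γ : C.Ob) (A : C.Ty Γ) (x : C.Tm Γ A) → C.Ty (Γ C.▹ A)
  IdC Γ A x = proj₁ (liftTy∫ (Γ C.▹ A) (F₀-▹ A) (ID.Id (F₀ Γ) (FTy A) (FTm x)))

  F-IdC : ∀ Γ A x → F∫Ty (IdC Γ A x) ≡ (F₀ Γ D.▹ FTy A , ID.Id (F₀ Γ) (FTy A) (FTm x))
  F-IdC Γ A x = proj₂ (liftTy∫ (Γ C.▹ A) (F₀-▹ A) (ID.Id (F₀ Γ) (FTy A) (FTm x)))

  F∫-IdC : ∀ {Γ} {A : C.Ty Γ} {x : C.Tm Γ A} {Z' A' x'} → F∫Tm x ≡ (Z' , A' , x') →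
           F∫Ty (IdC Γ A x) ≡ (Z' D.▹ A' , ID.Id Z' A' x')
  F∫-IdC hx = trans (F-IdC _ _ _) (Id-cong hx)

  reflLift : ∀ Γ A x → Σ (C.Tm Γ (IdC Γ A x C.[ OC.⟨ x ⟩ₓ ]T)) λ r →
             F∫Tm r ≡ (F₀ Γ , _ , ID.rfl (F₀ Γ) (FTy A) (FTm x))
  reflLift Γ A x =
    liftTm∫ Γ _ (F∫-[]T (F-IdC Γ A x) (F∫-⟨⟩ₓ refl)) (ID.rfl (F₀ Γ) (FTy A) (FTm x))

  reflC : (Γ : C.Ob) (A : C.Ty Γ) (x : C.Tm Γ A) → C.Tm Γ (IdC Γ A x C.[ OC.⟨ x ⟩ₓ ]T)
  reflC Γ A x = proj₁ (reflLift Γ A x)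

  module Elimination {Γ Δ : C.Ob} (A : C.Ty Γ) (x : C.Tm Γ A) (γ : C.Hom Δ Γ) where
    MotiveCtxC : C.Ob
    MotiveCtxC = Δ C.▹ A C.[ γ ]T C.▹ IdC Γ A x C.[ γ OC.⁺ ]T

    MotiveCtxD : D.Ob
    MotiveCtxD = F₀ Δ D.▹ FTy A D.[ F₁ γ ]T D.▹ ID.Id (F₀ Γ) (FTy A) (FTm x) D.[ F₁ γ OD.⁺ ]T

    σJC : C.Hom Δ MotiveCtxC
    σJC = OC.⟨id,_[_],_⟩ {B = IdC Γ A x} x γ (reflC Γ A x)

    σJD : D.Hom (F₀ Δ) MotiveCtxD
    σJD = ID.σJ (FTy A) (FTm x) (F₁ γ)

    F-MotiveCtx : F₀ MotiveCtxC ≡ MotiveCtxD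
    F-MotiveCtx = F∫-▹ (F∫-[]T (F-IdC Γ A x) (F∫-⁺ refl refl))

    F-σJ : F∫Hom σJC ≡ (F₀ Δ , MotiveCtxD , σJD)
    F-σJ = F∫-⟨id,[],⟩ (F-IdC Γ A x) refl refl (proj₂ (reflLift Γ A x))

    module _ (P : C.Ty MotiveCtxC) (d : C.Tm Δ (P C.[ σJC ]T)) where
      P̃ : D.Ty MotiveCtxD
      P̃ = subst D.Ty F-MotiveCtx (FTy P)

      F-P : F∫Ty P ≡ (MotiveCtxD , P̃)
      F-P = Ty∫-subst F-MotiveCtx (FTy P)

      F-P[σJ] : FTy (P C.[ σJC ]T) ≡ P̃ D.[ σJD ]T
      F-P[σJ] = ,-injectiveʳ (F∫-[]T F-P F-σJ)

      d̃ : D.Tm (F₀ Δ) (P̃ D.[ σJD ]T)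
      d̃ = subst (D.Tm (F₀ Δ)) F-P[σJ] (FTm d)

      F-d : F∫Tm d ≡ (F₀ Δ , P̃ D.[ σJD ]T , d̃)
      F-d = cong (F₀ Δ ,_) (OD.substΣ F-P[σJ] (FTm d))

      JD : D.Tm MotiveCtxD P̃
      JD = ID.J (F₀ Γ) (FTy A) (FTm x) (F₀ Δ) (F₁ γ) P̃ d̃

      JLift : Σ (C.Tm MotiveCtxC P) λ j → F∫Tm j ≡ (MotiveCtxD , P̃ , JD)
      JLift = liftTm∫ MotiveCtxC P F-P JD

      JC : C.Tm MotiveCtxC P
      JC = proj₁ JLift

      JβD : D.Tm (F₀ Δ) (ID.Id (F₀ Δ) (P̃ D.[ σJD ]T) d̃ D.[ OD.⟨ JD D.[ σJD ]t ⟩ₓ ]T)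
      JβD = ID.Jβ (F₀ Γ) (FTy A) (FTm x) (F₀ Δ) (F₁ γ) P̃ d̃

      JβLift : Σ (C.Tm Δ (IdC Δ (P C.[ σJC ]T) d C.[ OC.⟨ JC C.[ σJC ]t ⟩ₓ ]T)) λ b →
               F∫Tm b ≡ (F₀ Δ , ID.Id (F₀ Δ) (P̃ D.[ σJD ]T) d̃ D.[ OD.⟨ JD D.[ σJD ]t ⟩ₓ ]T , JβD)
      JβLift = liftTm∫ Δ _ (F∫-[]T (F∫-IdC F-d) (F∫-⟨⟩ₓ (F∫-[]t (proj₂ JLift) F-σJ))) JβD

      JβC : C.Tm Δ (IdC Δ (P C.[ σJC ]T) d C.[ OC.⟨ JC C.[ σJC ]t ⟩ₓ ]T)
      JβC = proj₁ JβLift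

      canonical-motive : ∀ P̃' → _≡_ {A = Ty∫} (F₀ MotiveCtxC , FTy P) (MotiveCtxD , P̃') →
                         P̃ ≡ P̃'
      canonical-motive P̃' hP = ,-injectiveʳ (trans (sym F-P) hP)

      canonical-method : ∀ {T} {d̃' : D.Tm (F₀ Δ) T} → OD.⌜ FTm d ⌝ ≡ OD.⌜ d̃' ⌝ → OD.⌜ d̃ ⌝ ≡ OD.⌜ d̃' ⌝
      canonical-method hd = trans (sym (OD.substΣ F-P[σJ] (FTm d))) hd

  open Elimination

  IdStrC : IdStr C
  IdStrC = record
    { Id  = IdC
    ; rfl = reflC
    ; J   = λ Γ A x Δ γ P d → JC A x γ P d
    ; Jβ  = λ Γ A x Δ γ P d → JβC A x γ P d
    }

  preserves : PreservesId F IdStrC ID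
  preserves = record
    { Id-pres   = F-IdC
    ; refl-pres = λ Γ A x → ,-injectiveʳ (proj₂ (reflLift Γ A x))
    ; J-pres    = λ Γ A x Δ γ P d P̃' d̃' hP hd →
        trans (proj₂ (JLift A x γ P d))
              (J-cong (canonical-motive A x γ P d P̃' hP) (canonical-method A x γ P d hd))
    ; Jβ-pres   = λ Γ A x Δ γ P d P̃' d̃' hP hd →
        trans (,-injectiveʳ (proj₂ (JβLift A x γ P d)))
              (Jβ-cong (canonical-motive A x γ P d P̃' hP) (canonical-method A x γ P d hd))
    }

proposition14 : ∀ {o h t u o' h' t' u' : Level}
                  {C : CwF o h t u} {D : CwF o' h' t' u'}
                  (F : Morphism C D) → TrivialFibration F →
                  (ID : IdStr D) → Σ (IdStr C) (λ IC → PreservesId F IC ID)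
proposition14 F TF ID = LiftedIdStr.IdStrC F TF ID , LiftedIdStr.preserves F TF ID
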